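{- Let $G$ be a finite graph with $\gamma_{1/2}(G)=1$, and let $P_m$ be the path on $m$ vertices ($m\ge 1$). Then $\gamma_{1/2}(G \square P_m) \geq \gamma_{1/2}(P_m)$.
   Context: For a graph $G=(V,E)$ and a vertex $v$, $N[v]$ denotes the closed neighborhood of $v$, and for $S\subseteq V$, $N[S]=\bigcup_{u\in S}N[u]$. For $p\in[0,1]$, a set $S\subseteq V$ is a $p$-dominating set if $|N[S]|/|V|\geq p$; $\gamma_p(G)$ is the minimum cardinality of a $p$-dominating set of $G$. $G\square H$ denotes the Cartesian product of graphs $G$ and $H$. -}

module Defs where

open import Data.Bool using (Bool; true; false; _∧_; _∨_)
open import Data.Nat using (ℕ; zero; suc; _*_; _≤_; _+_)
import Data.Nat as ℕ
open import Data.Fin using (Fin; zero; suc; toℕ; remQuot)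
import Data.Fin as Fin
open import Data.Fin.Subset using (Subset; ∣_∣)
open import Data.Vec using (lookup; tabulate)
open import Data.Product using (Σ; _×_; _,_; proj₁; proj₂)
open import Relation.Nullary.Decidable using (⌊_⌋)
open import Relation.Binary.PropositionalEquality using (_≡_)

record Graph : Set where
  constructor mkGraph
  field
    order : ℕ
    adj   : Fin order → Fin order → Bool
open Graph public

IsSimple : Graph → Set
IsSimple G = (∀ u v → adj G u v ≡ adj G v u) × (∀ v → adj G v v ≡ false)

_==_ : ∀ {n} → Fin n → Fin n → Bool
i == j = ⌊ i Fin.≟ j ⌋

anyFin : ∀ {n} → (Fin n → Bool) → Bool
anyFin {zero}  f = false
anyFin {suc n} f = f zero ∨ anyFin (λ i → f (suc i))

inClosedNbhd : (G : Graph) → Fin (order G) → Fin (order G) → Bool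
inClosedNbhd G v u = (u == v) ∨ adj G v u

closedNbhdSet : (G : Graph) → Subset (order G) → Subset (order G)
closedNbhdSet G S = tabulate (λ u → anyFin (λ v → lookup S v ∧ inClosedNbhd G v u))

-- S is a p-dominating set for p = a / b (b > 0):  |N[S]| / |V| ≥ a / b,
-- i.e.  a * |V| ≤ b * |N[S]|.
IsPDominating : (a b : ℕ) → (G : Graph) → Subset (order G) → Set
IsPDominating a b G S = a * order G ≤ b * ∣ closedNbhdSet G S ∣

IsGammaP : (a b : ℕ) → Graph → ℕ → Set
IsGammaP a b G k =
  Σ (Subset (order G)) (λ S → IsPDominating a b G S × ∣ S ∣ ≡ k)
  × (∀ (S : Subset (order G)) → IsPDominating a b G S → k ≤ ∣ S ∣)

IsGammaHalf : Graph → ℕ → Set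
IsGammaHalf = IsGammaP 1 2

pathGraph : ℕ → Graph
pathGraph m = mkGraph m (λ i j → ⌊ suc (toℕ i) ℕ.≟ toℕ j ⌋ ∨ ⌊ suc (toℕ j) ℕ.≟ toℕ i ⌋)

-- Cartesian product G □ H on Fin (|G| * |H|) ≅ Fin |G| × Fin |H| (via remQuot):
-- (g,h) ~ (g',h') iff (g = g' and h ~ h') or (h = h' and g ~ g').
cartesian : Graph → Graph → Graph
cartesian G H = mkGraph (order G * order H) adjP
  where
  adjP : Fin (order G * order H) → Fin (order G * order H) → Bool
  adjP x y with remQuot (order H) x | remQuot (order H) y
  ... | (g , h) | (g' , h') = ((g == g') ∧ adj H h h') ∨ ((h == h') ∧ adj G g g')

-- Project a set S of vertices of G □ H onto the H-coordinate.  The projection T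
-- has |T| ≤ |S|, and a vertex of G □ H dominated by S lies over a vertex of H
-- dominated by T, so |N[S]| ≤ |V(G)| |N[T]|.  Hence for non-empty G the projection of
-- a p-dominating set of G □ H is p-dominating in H, and γ_p(H) ≤ γ_p(G □ H).
module Submission where

open import Defs
open import Data.Nat using (ℕ; zero; suc; _+_; _*_; _≤_; z≤n; s≤s; NonZero; >-nonZero)
open import Data.Nat.Properties
open import Algebra.Properties.CommutativeSemigroup +-commutativeSemigroup using (interchange)
open import Algebra.Properties.CommutativeSemigroup *-commutativeSemigroup using (x∙yz≈y∙xz)
open import Data.Bool using (Bool; true; false; T; _∧_; _∨_)
open import Data.Bool.Properties using (T-∧; T-∨)
open import Data.Empty using (⊥-elim)
open import Data.Fin using (Fin; zero; suc; combine; remQuot; _↑ˡ_; _↑ʳ_)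
open import Data.Fin.Properties using (remQuot-combine; combine-remQuot)
open import Data.Fin.Subset using (Subset; ∣_∣)
open import Data.Fin.Subset.Properties using (∣p∣≤n)
open import Data.Vec using (lookup; tabulate)
open import Data.Vec.Properties using (lookup∘tabulate; tabulate∘lookup)
open import Data.Product using (∃; _,_; proj₁; proj₂)
open import Data.Sum using (_⊎_; inj₁; inj₂)
import Data.Sum as Sum
open import Function using (id; _∘_)
open import Function.Bundles using (Equivalence)
open import Relation.Nullary.Decidable using (toWitness; fromWitness)
open import Relation.Binary.PropositionalEquality

open Equivalence using (to; from)

indicator : Bool → ℕ
indicator true  = 1
indicator false = 0

count : ∀ {n} → (Fin n → Bool) → ℕ
count {zero}  f = 0
count {suc n} f = indicator (f zero) + count (λ i → f (suc i))

indicator-mono : ∀ {a b} → (T a → T b) → indicator a ≤ indicator b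
indicator-mono {false}         _   = z≤n
indicator-mono {true}  {true}  _   = ≤-refl
indicator-mono {true}  {false} a⇒b = ⊥-elim (a⇒b _)

indicator-∨ : ∀ a b → indicator (a ∨ b) ≤ indicator a + indicator b
indicator-∨ true  b = s≤s z≤n
indicator-∨ false b = ≤-refl

count-mono : ∀ {n} {f g : Fin n → Bool} → (∀ i → T (f i) → T (g i)) → count f ≤ count g
count-mono {zero}  f⇒g = z≤n
count-mono {suc n} f⇒g = +-mono-≤ (indicator-mono (f⇒g zero)) (count-mono (λ i → f⇒g (suc i)))

count-∨ : ∀ {n} (f g : Fin n → Bool) → count (λ i → f i ∨ g i) ≤ count f + count g
count-∨ {zero}  f g = z≤n
count-∨ {suc n} f g = begin
  indicator (f zero ∨ g zero) + count (λ i → f (suc i) ∨ g (suc i))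
    ≤⟨ +-mono-≤ (indicator-∨ (f zero) (g zero)) (count-∨ (λ i → f (suc i)) (λ i → g (suc i))) ⟩
  (indicator (f zero) + indicator (g zero)) + (count (λ i → f (suc i)) + count (λ i → g (suc i)))
    ≡⟨ interchange (indicator (f zero)) _ _ _ ⟩
  count f + count g ∎
  where open ≤-Reasoning

count-false : ∀ n → count {n} (λ _ → false) ≡ 0
count-false zero    = refl
count-false (suc n) = count-false n

count-↑ : ∀ m {n} (f : Fin (m + n) → Bool) →
  count f ≡ count (λ i → f (i ↑ˡ n)) + count (λ j → f (m ↑ʳ j))
count-↑ zero    f = refl
count-↑ (suc m) f =
  trans (cong (indicator (f zero) +_) (count-↑ m (λ i → f (suc i))))
        (sym (+-assoc (indicator (f zero)) _ _))

∣tabulate∣≡count : ∀ {n} (f : Fin n → Bool) → ∣ tabulate f ∣ ≡ count f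
∣tabulate∣≡count {zero}  f = refl
∣tabulate∣≡count {suc n} f with f zero
... | true  = cong suc (∣tabulate∣≡count (λ i → f (suc i)))
... | false = ∣tabulate∣≡count (λ i → f (suc i))

∣p∣≡count : ∀ {n} (p : Subset n) → ∣ p ∣ ≡ count (lookup p)
∣p∣≡count p = trans (cong ∣_∣ (sym (tabulate∘lookup p))) (∣tabulate∣≡count (lookup p))

count-combine-≤ : ∀ n {m c} (f : Fin (n * m) → Bool) →
  (∀ (g : Fin n) → count (λ (h : Fin m) → f (combine g h)) ≤ c) → count f ≤ n * c
count-combine-≤ zero    f rows = z≤n
count-combine-≤ (suc n) {m} {c} f rows = begin
  count f
    ≡⟨ count-↑ m f ⟩
  count (λ h → f (h ↑ˡ (n * m))) + count (λ j → f (m ↑ʳ j))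
    ≤⟨ +-mono-≤ (rows zero) (count-combine-≤ n (λ j → f (m ↑ʳ j)) (λ g → rows (suc g))) ⟩
  c + n * c ∎
  where open ≤-Reasoning

count-anyFin-combine-≤ : ∀ n {m} (f : Fin (n * m) → Bool) →
  count (λ (h : Fin m) → anyFin (λ (g : Fin n) → f (combine g h))) ≤ count f
count-anyFin-combine-≤ zero    {m} f = ≤-reflexive (count-false m)
count-anyFin-combine-≤ (suc n) {m} f = begin
  count (λ (h : Fin m) → f (combine (zero {n}) h) ∨ anyFin (λ (g : Fin n) → f (combine (suc g) h)))
    ≤⟨ count-∨ (λ (h : Fin m) → f (combine (zero {n}) h)) _ ⟩
  count (λ h → f (h ↑ˡ (n * m))) + count (λ (h : Fin m) → anyFin (λ (g : Fin n) → f (m ↑ʳ combine g h)))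
    ≤⟨ +-monoʳ-≤ (count (λ h → f (h ↑ˡ (n * m)))) (count-anyFin-combine-≤ n (λ j → f (m ↑ʳ j))) ⟩
  count (λ h → f (h ↑ˡ (n * m))) + count (λ j → f (m ↑ʳ j))
    ≡⟨ count-↑ m f ⟨
  count f ∎
  where open ≤-Reasoning

T-anyFin⁺ : ∀ {n} (f : Fin n → Bool) i → T (f i) → T (anyFin f)
T-anyFin⁺ f zero    fi = from T-∨ (inj₁ fi)
T-anyFin⁺ f (suc i) fi = from T-∨ (inj₂ (T-anyFin⁺ (λ j → f (suc j)) i fi))

T-anyFin⁻ : ∀ {n} (f : Fin n → Bool) → T (anyFin f) → ∃ λ i → T (f i)
T-anyFin⁻ {suc n} f any with to T-∨ any
... | inj₁ f0   = zero , f0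
... | inj₂ rest with i , fi ← T-anyFin⁻ (λ j → f (suc j)) rest = suc i , fi

T-lookup-tabulate⁺ : ∀ {n} (f : Fin n → Bool) i → T (f i) → T (lookup (tabulate f) i)
T-lookup-tabulate⁺ f i = subst T (sym (lookup∘tabulate f i))

T-lookup-tabulate⁻ : ∀ {n} (f : Fin n → Bool) i → T (lookup (tabulate f) i) → T (f i)
T-lookup-tabulate⁻ f i = subst T (lookup∘tabulate f i)

module _ (G H : Graph) where

  coordᴳ : Fin (order G * order H) → Fin (order G)
  coordᴳ x = proj₁ (remQuot {order G} (order H) x)

  coordᴴ : Fin (order G * order H) → Fin (order H)
  coordᴴ x = proj₂ (remQuot {order G} (order H) x)

  inProjection : Subset (order G * order H) → Fin (order H) → Bool
  inProjection S h = anyFin (λ (g : Fin (order G)) → lookup S (combine g h))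

  project : Subset (order G * order H) → Subset (order H)
  project S = tabulate (inProjection S)

  ∣project∣≤∣S∣ : ∀ S → ∣ project S ∣ ≤ ∣ S ∣
  ∣project∣≤∣S∣ S = begin
    ∣ project S ∣       ≡⟨ ∣tabulate∣≡count (inProjection S) ⟩
    count (inProjection S) ≤⟨ count-anyFin-combine-≤ (order G) (lookup S) ⟩
    count (lookup S)    ≡⟨ ∣p∣≡count S ⟨
    ∣ S ∣ ∎
    where open ≤-Reasoning

  adj-coordᴴ : ∀ y x → T (adj (cartesian G H) y x) →
    coordᴴ x ≡ coordᴴ y ⊎ T (adj H (coordᴴ y) (coordᴴ x))
  adj-coordᴴ y x y-x with to (T-∨ {(coordᴳ y == coordᴳ x) ∧ adj H (coordᴴ y) (coordᴴ x)}) y-x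
  ... | inj₁ sameG = inj₂ (proj₂ (to T-∧ sameG))
  ... | inj₂ sameH = inj₁ (sym (toWitness (proj₁ (to (T-∧ {coordᴴ y == coordᴴ x}) sameH))))

  inClosedNbhd-coordᴴ : ∀ y x →
    T (inClosedNbhd (cartesian G H) y x) → T (inClosedNbhd H (coordᴴ y) (coordᴴ x))
  inClosedNbhd-coordᴴ y x y~x = from (T-∨ {coordᴴ x == coordᴴ y}) (Sum.map fromWitness id coord~)
    where
    coord~ : coordᴴ x ≡ coordᴴ y ⊎ T (adj H (coordᴴ y) (coordᴴ x))
    coord~ with to (T-∨ {x == y}) y~x
    ... | inj₁ x≡y = inj₁ (cong coordᴴ (toWitness x≡y))
    ... | inj₂ y-x = adj-coordᴴ y x y-x

  ∈-project : ∀ S y → T (lookup S y) → T (lookup (project S) (coordᴴ y))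
  ∈-project S y y∈S =
    T-lookup-tabulate⁺ (inProjection S) (coordᴴ y)
      (T-anyFin⁺ (λ g → lookup S (combine g (coordᴴ y))) (coordᴳ y)
        (subst (T ∘ lookup S) (sym (combine-remQuot {order G} (order H) y)) y∈S))

  ∈N[S]⇒coordᴴ∈N[project] : ∀ S x → T (lookup (closedNbhdSet (cartesian G H) S) x) →
    T (lookup (closedNbhdSet H (project S)) (coordᴴ x))
  ∈N[S]⇒coordᴴ∈N[project] S x x∈N[S]
    with y , y∈S∧y~x ← T-anyFin⁻ (λ y → lookup S y ∧ inClosedNbhd (cartesian G H) y x)
                         (T-lookup-tabulate⁻ _ x x∈N[S])
    with y∈S , y~x ← to (T-∧ {lookup S y}) y∈S∧y~x
    = T-lookup-tabulate⁺ _ (coordᴴ x)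
        (T-anyFin⁺ (λ h → lookup (project S) h ∧ inClosedNbhd H h (coordᴴ x)) (coordᴴ y)
          (from T-∧ (∈-project S y y∈S , inClosedNbhd-coordᴴ y x y~x)))

  ∣N[S]∣≤∣G∣*∣N[project]∣ : ∀ S →
    ∣ closedNbhdSet (cartesian G H) S ∣ ≤ order G * ∣ closedNbhdSet H (project S) ∣
  ∣N[S]∣≤∣G∣*∣N[project]∣ S = begin
    ∣ N[S] ∣                   ≡⟨ ∣p∣≡count N[S] ⟩
    count (lookup N[S])        ≤⟨ count-combine-≤ (order G) (lookup N[S]) (λ g → count-mono (row⊆N[T] g)) ⟩
    order G * count (lookup N[T]) ≡⟨ cong (order G *_) (∣p∣≡count N[T]) ⟨
    order G * ∣ N[T] ∣ ∎
    where
    open ≤-Reasoning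
    N[S] = closedNbhdSet (cartesian G H) S
    N[T] = closedNbhdSet H (project S)
    row⊆N[T] : ∀ g h → T (lookup N[S] (combine g h)) → T (lookup N[T] h)
    row⊆N[T] g h = subst (T ∘ lookup N[T]) (cong proj₂ (remQuot-combine g h))
                 ∘ ∈N[S]⇒coordᴴ∈N[project] S (combine g h)

  IsPDominating-project : ∀ a b S .{{_ : NonZero (order G)}} →
    IsPDominating a b (cartesian G H) S → IsPDominating a b H (project S)
  IsPDominating-project a b S dom = *-cancelˡ-≤ (order G) (begin
    order G * (a * order H)    ≡⟨ x∙yz≈y∙xz (order G) a (order H) ⟩
    a * (order G * order H)    ≤⟨ dom ⟩
    b * ∣ closedNbhdSet (cartesian G H) S ∣ ≤⟨ *-monoʳ-≤ b (∣N[S]∣≤∣G∣*∣N[project]∣ S) ⟩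
    b * (order G * ∣ closedNbhdSet H (project S) ∣) ≡⟨ x∙yz≈y∙xz b (order G) _ ⟩
    order G * (b * ∣ closedNbhdSet H (project S) ∣) ∎)
    where open ≤-Reasoning

  IsGammaP-cartesian-≥ : ∀ {a b k l} .{{_ : NonZero (order G)}} →
    IsGammaP a b (cartesian G H) k → IsGammaP a b H l → l ≤ k
  IsGammaP-cartesian-≥ {a} {b} {k} {l} ((S , dom , ∣S∣≡k) , _) (_ , l-minimal) = begin
    l             ≤⟨ l-minimal (project S) (IsPDominating-project a b S dom) ⟩
    ∣ project S ∣ ≤⟨ ∣project∣≤∣S∣ S ⟩
    ∣ S ∣         ≡⟨ ∣S∣≡k ⟩
    k             ∎
    where open ≤-Reasoning

nonZero-order : ∀ a b (G : Graph) → IsGammaP a b G 1 → NonZero (order G)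
nonZero-order _ _ G ((S , _ , ∣S∣≡1) , _) = >-nonZero (subst (_≤ order G) ∣S∣≡1 (∣p∣≤n S))

mainTheorem5 : (G : Graph) → IsSimple G → IsGammaHalf G 1 →
    (m : ℕ) → 1 ≤ m → (k l : ℕ) →
    IsGammaHalf (cartesian G (pathGraph m)) k → IsGammaHalf (pathGraph m) l →
    l ≤ k
mainTheorem5 G _ γG≡1 m _ k l γG□P≡k γP≡l =
  IsGammaP-cartesian-≥ G (pathGraph m) {a = 1} {b = 2} {{nonZero-order 1 2 G γG≡1}} γG□P≡k γP≡l
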